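{- Let $m,n,t$ be integers with $m,n>1$ and $t>2$. Let $\mathbb{T}\subseteq\mathbb{Z}^2$ be a rectilinear broadcast, i.e. a set of the form $\mathbb{T}=\{(x_0+(t-1)a,\ y_0+(t-1)b): a,b\in\mathbb{Z},\ a+b \text{ even}\}$ for some fixed $(x_0,y_0)\in\mathbb{Z}^2$. Let $V_G=\{(i,j)\in\mathbb{Z}^2: 0\le i<m,\ 0\le j<n\}$ and $V_H=\{(i,j)\in\mathbb{Z}^2: -(t-2)\le i<m+(t-2),\ -(t-2)\le j<n+(t-2)\}$. Then for every $v\in V_G$, \[\sum_{T\in V_H\cap\mathbb{T}} \max\bigl(t-d(T,v),0\bigr)\ \ge\ 2,\] where $d((a,b),(c,d))=|a-c|+|b-d|$.
   Context: Here $d$ is the graph distance in the infinite grid graph on $\mathbb{Z}^2$ (vertices adjacent iff they differ by 1 in exactly one coordinate), and $\max(t-d(T,v),0)$ is the signal supplied by a tower $T$ of strength $t$ to vertex $v$. -}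

module Defs where

open import Data.Integer using (ℤ; +_; _+_; _-_; _*_; ∣_∣; _⊔_; _≤_; _<_; -_)
open import Data.Integer.Divisibility using (_∣_)
open import Data.Product using (_×_; _,_; ∃-syntax)
open import Data.List using (List; []; _∷_)
open import Relation.Binary.PropositionalEquality using (_≡_)

Point : Set
Point = ℤ × ℤ

dist : Point → Point → ℤ
dist (a , b) (c , d) = + (∣ a - c ∣ +ℕ ∣ b - d ∣)
  where open import Data.Nat using () renaming (_+_ to _+ℕ_)

signal : ℤ → Point → Point → ℤ
signal t T v = (t - dist T v) ⊔ + 0

InBroadcast : ℤ → Point → Point → Set
InBroadcast t (x0 , y0) (x , y) =
  ∃[ a ] ∃[ b ] ((+ 2 ∣ (a + b)) × (x ≡ x0 + (t - + 1) * a) × (y ≡ y0 + (t - + 1) * b))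

InVG : ℤ → ℤ → Point → Set
InVG m n (i , j) = (+ 0 ≤ i × i < m) × (+ 0 ≤ j × j < n)

InVH : ℤ → ℤ → ℤ → Point → Set
InVH m n t (i , j) =
  (- (t - + 2) ≤ i × i < m + (t - + 2)) × (- (t - + 2) ≤ j × j < n + (t - + 2))

sumL : (Point → ℤ) → List Point → ℤ
sumL f [] = + 0
sumL f (p ∷ ps) = f p + sumL f ps

module Submission where

-- Write s = t - 1 for the spacing of the broadcast lattice and
-- v = (X , Y) ∈ V_G.  In each coordinate separately, v lies in a *cell*
-- between two consecutive lattice lines x0 + s·a ≤ X ≤ x0 + s·(a + 1), and
-- the cell can be chosen so that both lines lie in the window
-- [-(t - 2), m + (t - 2)) cutting out V_H (m > 1 is needed only when X = 0).
-- The four corners of the resulting square are points of the rectilinear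
-- lattice, and by parity of a + b exactly one of its two diagonals joins two
-- points of the broadcast.  The two ends T₁ ≠ T₂ of that diagonal are towers
-- of V_H whose distances to v add up to the sum of the two cell widths,
-- 2s = 2(t - 1); hence their signals add up to at least 2t - 2(t - 1) = 2,
-- and the sum of all (non-negative) signals over V_H ∩ 𝕋 is at least that.

open import Defs
open import Data.Integer using (ℤ; +_; _≤_; _<_)
open import Data.Product using (_×_)
open import Data.List using (List)
open import Data.List.Membership.Propositional using (_∈_)
open import Data.List.Relation.Unary.Unique.Propositional using (Unique)
open import Function.Bundles using (_⇔_)

open import Data.Nat as ℕ using (ℕ; zero; suc; z≤n; s≤s)
import Data.Nat.Properties as ℕP
open import Data.Integer using (_+_; _-_; _*_; -_; ∣_∣; +≤+; +<+; nonNegative)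
import Data.Integer.Properties as ℤP
open import Data.Integer.DivMod using (_%ℕ_; _/ℕ_; a≡a%ℕn+[a/ℕn]*n; n%ℕd<d)
open import Data.Integer.Divisibility using (_∣_)
open import Data.Integer.Divisibility.Signed as Signed
  using (divides; ∣⇒∣ᵤ) renaming (_∣_ to _∣ˢ_)
open import Data.Integer.Tactic.RingSolver using (solve-∀)
open import Algebra.Properties.CommutativeSemigroup ℕP.+-commutativeSemigroup
  using (interchange)
open import Data.Product using (Σ-syntax; ∃-syntax; _,_; proj₂)
open import Data.Sum using (_⊎_; inj₁; inj₂)
open import Data.List using ([]; _∷_)
open import Data.List.Relation.Unary.Any using (here; there)
open import Relation.Binary.PropositionalEquality
open import Data.Empty using (⊥-elim)
open import Function.Bundles using (Equivalence)

module NonNegativeSum (f : Point → ℤ) (f≥0 : ∀ p → + 0 ≤ f p) where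

  sumL-nonneg : ∀ L → + 0 ≤ sumL f L
  sumL-nonneg []      = ℤP.≤-refl
  sumL-nonneg (p ∷ L) = ℤP.+-mono-≤ (f≥0 p) (sumL-nonneg L)

  sumL-≥-member : ∀ {x} L → x ∈ L → f x ≤ sumL f L
  sumL-≥-member (p ∷ L) (here refl) =
    ℤP.i≤i+j (f p) (sumL f L) {{nonNegative (sumL-nonneg L)}}
  sumL-≥-member (p ∷ L) (there x∈L) =
    ℤP.i≤j⇒i≤k+j (f p) {{nonNegative (f≥0 p)}} (sumL-≥-member L x∈L)

  sumL-≥-pair : ∀ {x y} L → x ≢ y → x ∈ L → y ∈ L → f x + f y ≤ sumL f L
  sumL-≥-pair (p ∷ L) x≢y (here refl) (here refl) = ⊥-elim (x≢y refl)
  sumL-≥-pair (p ∷ L) x≢y (here refl) (there y∈L) =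
    ℤP.+-monoʳ-≤ (f p) (sumL-≥-member L y∈L)
  sumL-≥-pair {x} (p ∷ L) x≢y (there x∈L) (here refl) =
    subst (_≤ f p + sumL f L) (ℤP.+-comm (f p) (f x))
      (ℤP.+-monoʳ-≤ (f p) (sumL-≥-member L x∈L))
  sumL-≥-pair (p ∷ L) x≢y (there x∈L) (there y∈L) =
    ℤP.i≤j⇒i≤k+j (f p) {{nonNegative (f≥0 p)}} (sumL-≥-pair L x≢y x∈L y∈L)

signal-≥ : ∀ t T v → t - dist T v ≤ signal t T v
signal-≥ t T v = ℤP.i≤i⊔j (t - dist T v) (+ 0)

signal-nonneg : ∀ t T v → + 0 ≤ signal t T v
signal-nonneg t T v = ℤP.i≤j⊔i (t - dist T v) (+ 0)

signal-pair : ∀ t T₁ T₂ v → dist T₁ v + dist T₂ v ≡ (t - + 1) + (t - + 1)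
  → + 2 ≤ signal t T₁ v + signal t T₂ v
signal-pair t T₁ T₂ v d₁+d₂ = ℤP.≤-trans (ℤP.≤-reflexive two≡)
  (ℤP.+-mono-≤ (signal-≥ t T₁ v) (signal-≥ t T₂ v))
  where
  open ≡-Reasoning
  d₁ d₂ : ℤ
  d₁ = dist T₁ v
  d₂ = dist T₂ v
  regroup : ∀ (t a b : ℤ) → (t - a) + (t - b) ≡ (t + t) - (a + b)
  regroup = solve-∀
  cancel : ∀ (t : ℤ) → (t + t) - ((t - + 1) + (t - + 1)) ≡ + 2
  cancel = solve-∀
  two≡ : + 2 ≡ (t - d₁) + (t - d₂)
  two≡ = sym (begin
    (t - d₁) + (t - d₂)                      ≡⟨ regroup t d₁ d₂ ⟩
    (t + t) - (d₁ + d₂)                      ≡⟨ cong (λ d → (t + t) - d) d₁+d₂ ⟩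
    (t + t) - ((t - + 1) + (t - + 1))        ≡⟨ cancel t ⟩
    + 2                                      ∎)

data End : Set where
  lo hi : End

opposite : End → End
opposite lo = hi
opposite hi = lo

corner : ℤ → End → ℤ
corner a lo = a
corner a hi = a + + 1

-- A cell of the lattice x0 + s·ℤ around z: z lies `below` steps above the
-- lattice point x0 + s·index and `above` steps below x0 + s·(index + 1).
record Cell (s : ℕ) (x0 z : ℤ) : Set where
  field
    index       : ℤ
    below above : ℕ
    width       : below ℕ.+ above ≡ s
    lower       : z - + below ≡ x0 + + s * index

  gap : End → ℕ
  gap lo = below
  gap hi = above

  point : End → ℤ
  point lo = z - + below
  point hi = z + + above

  upper : z + + above ≡ x0 + + s * (index + + 1)
  upper = begin
    z + + above                                ≡⟨ shift z (+ below) (+ above) ⟩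
    (z - + below) + (+ below + + above)        ≡⟨ cong₂ _+_ lower (cong +_ width) ⟩
    (x0 + + s * index) + + s                   ≡⟨ step x0 (+ s) index ⟩
    x0 + + s * (index + + 1)                   ∎
    where
    open ≡-Reasoning
    shift : ∀ (z b c : ℤ) → z + c ≡ (z - b) + (b + c)
    shift = solve-∀
    step : ∀ (x0 s a : ℤ) → (x0 + s * a) + s ≡ x0 + s * (a + + 1)
    step = solve-∀

  onLattice : ∀ e → point e ≡ x0 + + s * corner index e
  onLattice lo = lower
  onLattice hi = upper

  distance : ∀ e → ∣ point e - z ∣ ≡ gap e
  distance lo = trans (cong ∣_∣ (down z (+ below))) (ℤP.∣-i∣≡∣i∣ (+ below))
    where
    down : ∀ (z b : ℤ) → (z - b) - z ≡ - b
    down = solve-∀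
  distance hi = cong ∣_∣ (up z (+ above))
    where
    up : ∀ (z c : ℤ) → (z + c) - z ≡ c
    up = solve-∀

  gap-sum : ∀ e → gap e ℕ.+ gap (opposite e) ≡ s
  gap-sum lo = width
  gap-sum hi = trans (ℕP.+-comm above below) width

ends-distinct : ∀ {k x0 z} (C : Cell (suc k) x0 z) → Cell.point C lo ≢ Cell.point C hi
ends-distinct {k} {x0} {z} C lo≡hi = ℕP.1+n≢0 (ℤP.+-injective (begin
  + suc k                               ≡⟨ cong +_ width ⟨
  + below + + above                     ≡⟨ spread z (+ below) (+ above) ⟩
  (z + + above) - (z - + below)         ≡⟨ cong (λ w → (z + + above) - w) lo≡hi ⟩
  (z + + above) - (z + + above)         ≡⟨ ℤP.+-inverseʳ (z + + above) ⟩
  + 0                                   ∎))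
  where
  open Cell C
  open ≡-Reasoning
  spread : ∀ (z b c : ℤ) → b + c ≡ (z + c) - (z - b)
  spread = solve-∀

-- Euclidean division of z - x0 by s = k + 1, read off at z: the largest
-- lattice point not above z is z - r with r + r' = k.
floor-division : ∀ k x0 z → ∃[ a ] ∃[ r ] ∃[ r' ]
  (r ℕ.+ r' ≡ k × z - + r ≡ x0 + + suc k * a)
floor-division k x0 z =
  q , r , k ℕ.∸ r , ℕP.m+[n∸m]≡n r≤k , (begin
    z - + r                         ≡⟨ around z x0 (+ r) ⟩
    x0 + (z - x0) - + r             ≡⟨ cong (λ w → x0 + w - + r) division ⟩
    x0 + (+ r + q * + suc k) - + r  ≡⟨ cancel x0 (+ r) q (+ suc k) ⟩
    x0 + + suc k * q                ∎)
  where
  open ≡-Reasoning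
  r : ℕ
  r = (z - x0) %ℕ suc k
  q : ℤ
  q = (z - x0) /ℕ suc k
  division : z - x0 ≡ + r + q * + suc k
  division = a≡a%ℕn+[a/ℕn]*n (z - x0) (suc k)
  r≤k : r ℕ.≤ k
  r≤k = ℕP.≤-pred (n%ℕd<d (z - x0) (suc k))
  around : ∀ (z x0 r : ℤ) → z - r ≡ x0 + (z - x0) - r
  around = solve-∀
  cancel : ∀ (x0 r q s : ℤ) → x0 + (r + q * s) - r ≡ x0 + s * q
  cancel = solve-∀

InWindow : ℤ → ℤ → ℤ → Set
InWindow w m z = - w ≤ z × z < m + w

lower-in-window : ∀ {k M X b} → b ℕ.≤ X ℕ.+ k → X ℕ.< M
  → InWindow (+ k) (+ M) (+ X - + b)
lower-in-window {k} {M} {X} {b} b≤X+k X<M = above-bottom , below-top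
  where
  open ℤP.≤-Reasoning
  minus-sum : ∀ (x k : ℤ) → x - (x + k) ≡ - k
  minus-sum = solve-∀
  above-bottom : - + k ≤ + X - + b
  above-bottom = begin
    - + k               ≡⟨ minus-sum (+ X) (+ k) ⟨
    + X - (+ X + + k)   ≤⟨ ℤP.+-monoʳ-≤ (+ X) (ℤP.neg-mono-≤ (+≤+ b≤X+k)) ⟩
    + X - + b           ∎
  below-top : + X - + b < + M + + k
  below-top = ℤP.≤-<-trans (ℤP.i-j≤i (+ X) (+ b))
    (+<+ (ℕP.<-≤-trans X<M (ℕP.m≤m+n M k)))

upper-in-window : ∀ {k M X c} → X ℕ.+ c ℕ.< M ℕ.+ k
  → InWindow (+ k) (+ M) (+ X + + c)
upper-in-window X+c<M+k = ℤP.neg-≤-pos , +<+ X+c<M+k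

-- If X = 0 take the cell whose lower
-- end is the lattice point just below 0 (at most k below it); if X ≥ 1
-- take the cell whose lower end is strictly below X (at most k + 1 below).
cell-in-window : ∀ k M x0 X → 2 ℕ.≤ M → X ℕ.< M →
  Σ[ C ∈ Cell (suc k) x0 (+ X) ] (∀ e → InWindow (+ k) (+ M) (Cell.point C e))
cell-in-window k M x0 zero 2≤M 0<M
  with floor-division k x0 (+ 0)
... | a , r , r' , r+r'≡k , lower = C , window
  where
  C : Cell (suc k) x0 (+ 0)
  C = record { index = a ; below = r ; above = suc r'
             ; width = trans (ℕP.+-suc r r') (cong suc r+r'≡k) ; lower = lower }
  r≤k : r ℕ.≤ k
  r≤k = subst (r ℕ.≤_) r+r'≡k (ℕP.m≤m+n r r')
  r'≤k : r' ℕ.≤ k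
  r'≤k = subst (r' ℕ.≤_) r+r'≡k (ℕP.m≤n+m r' r)
  window : ∀ e → InWindow (+ k) (+ M) (Cell.point C e)
  window lo = lower-in-window r≤k 0<M
  window hi = upper-in-window {X = 0} (ℕP.+-mono-≤ 2≤M r'≤k)
cell-in-window k M x0 (suc Y) 2≤M X<M
  with floor-division k x0 (+ Y)
... | a , r , r' , r+r'≡k , lower = C , window
  where
  step-both : ∀ (y r : ℤ) → (+ 1 + y) - (+ 1 + r) ≡ y - r
  step-both = solve-∀
  C : Cell (suc k) x0 (+ suc Y)
  C = record { index = a ; below = suc r ; above = r'
             ; width = cong suc r+r'≡k ; lower = trans (step-both (+ Y) (+ r)) lower }
  r≤k : r ℕ.≤ k
  r≤k = subst (r ℕ.≤_) r+r'≡k (ℕP.m≤m+n r r')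
  r'≤k : r' ℕ.≤ k
  r'≤k = subst (r' ℕ.≤_) r+r'≡k (ℕP.m≤n+m r' r)
  window : ∀ e → InWindow (+ k) (+ M) (Cell.point C e)
  window lo = lower-in-window (s≤s (ℕP.≤-trans r≤k (ℕP.m≤n+m k Y))) X<M
  window hi = upper-in-window {X = suc Y} (ℕP.+-mono-<-≤ X<M r'≤k)

even-or-odd : ∀ i → + 2 ∣ˢ i ⊎ + 2 ∣ˢ i + + 1
even-or-odd i with i %ℕ 2 | a≡a%ℕn+[a/ℕn]*n i 2 | n%ℕd<d i 2
... | 0 | i≡ | _ = inj₁ (divides q (trans i≡ (ℤP.+-identityˡ (q * + 2))))
  where
  q : ℤ
  q = i /ℕ 2
... | 1 | i≡ | _ = inj₂ (divides (q + + 1) (trans (cong (_+ + 1) i≡) (next q)))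
  where
  q : ℤ
  q = i /ℕ 2
  next : ∀ q → (+ 1 + q * + 2) + + 1 ≡ (q + + 1) * + 2
  next = solve-∀
... | suc (suc _) | _ | s≤s (s≤s ())

diagonal-parity : ∀ a b → ∃[ e ]
  ((+ 2 ∣ (corner a e + b)) × (+ 2 ∣ (corner a (opposite e) + (b + + 1))))
diagonal-parity a b with even-or-odd (a + b)
... | inj₁ even = lo , ∣⇒∣ᵤ even , ∣⇒∣ᵤ (subst (+ 2 ∣ˢ_) (shift-both a b)
                                      (Signed.∣m∣n⇒∣m+n even Signed.∣-refl))
  where
  shift-both : ∀ a b → (a + b) + + 2 ≡ (a + + 1) + (b + + 1)
  shift-both = solve-∀
... | inj₂ odd = hi , ∣⇒∣ᵤ (subst (+ 2 ∣ˢ_) (shift-left a b) odd)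
                    , ∣⇒∣ᵤ (subst (+ 2 ∣ˢ_) (shift-right a b) odd)
  where
  shift-left : ∀ a b → (a + b) + + 1 ≡ (a + + 1) + b
  shift-left = solve-∀
  shift-right : ∀ a b → (a + b) + + 1 ≡ a + (b + + 1)
  shift-right = solve-∀

diagonal-distance : ∀ {s x0 y0 X Y} (Cx : Cell s x0 X) (Cy : Cell s y0 Y) e
  → dist (Cell.point Cx e , Cell.point Cy lo) (X , Y)
    + dist (Cell.point Cx (opposite e) , Cell.point Cy hi) (X , Y) ≡ + s + + s
diagonal-distance {s} Cx Cy e = begin
  dist (Cx.point e , Cy.point lo) _ + dist (Cx.point (opposite e) , Cy.point hi) _
    ≡⟨ cong₂ _+_ (cong₂ sum (Cx.distance e) (Cy.distance lo))
                 (cong₂ sum (Cx.distance (opposite e)) (Cy.distance hi)) ⟩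
  + ((Cx.gap e ℕ.+ Cy.below) ℕ.+ (Cx.gap (opposite e) ℕ.+ Cy.above))
    ≡⟨ cong +_ (interchange (Cx.gap e) Cy.below (Cx.gap (opposite e)) Cy.above) ⟩
  + ((Cx.gap e ℕ.+ Cx.gap (opposite e)) ℕ.+ (Cy.below ℕ.+ Cy.above))
    ≡⟨ cong +_ (cong₂ ℕ._+_ (Cx.gap-sum e) Cy.width) ⟩
  + s + + s ∎
  where
  module Cx = Cell Cx
  module Cy = Cell Cy
  open ≡-Reasoning
  sum : ℕ → ℕ → ℤ
  sum p q = + (p ℕ.+ q)

lemma5 : (m n t : ℤ) → + 1 < m → + 1 < n → + 2 < t → (o : Point)
    → (L : List Point) → Unique L
    → (∀ p → (p ∈ L) ⇔ (InVH m n t p × InBroadcast t o p))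
    → ∀ v → InVG m n v → + 2 ≤ sumL (λ T → signal t T v) L
-- Here t = k + 3, so the lattice spacing is t - 1 = k + 2 and the window of
-- V_H has half-width t - 2 = k + 1.
lemma5 (+ M) (+ N) (+ suc (suc (suc k))) (+<+ 2≤M) (+<+ 2≤N) (+<+ (s≤s (s≤s (s≤s z≤n))))
       (x0 , y0) L _ L↔ (+ X , + Y) ((+≤+ z≤n , +<+ X<M) , (+≤+ z≤n , +<+ Y<N))
  with cell-in-window (suc k) M x0 X 2≤M X<M | cell-in-window (suc k) N y0 Y 2≤N Y<N
... | Cx , x-window | Cy , y-window
  with diagonal-parity (Cell.index Cx) (Cell.index Cy)
... | e , even₁ , even₂ =
  ℤP.≤-trans (signal-pair t T₁ T₂ v (diagonal-distance Cx Cy e))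
             (sumL-≥-pair (λ T → signal t T v) (λ T → signal-nonneg t T v)
                          L T₁≢T₂ T₁∈L T₂∈L)
  where
  open NonNegativeSum using (sumL-≥-pair)
  t : ℤ
  t = + suc (suc (suc k))
  v : Point
  v = (+ X , + Y)
  T₁ T₂ : Point
  T₁ = Cell.point Cx e , Cell.point Cy lo
  T₂ = Cell.point Cx (opposite e) , Cell.point Cy hi
  T₁≢T₂ : T₁ ≢ T₂
  T₁≢T₂ eq = ends-distinct Cy (cong proj₂ eq)
  T₁∈L : T₁ ∈ L
  T₁∈L = Equivalence.from (L↔ T₁)
    ( (x-window e , y-window lo)
    , corner (Cell.index Cx) e , Cell.index Cy , even₁
    , Cell.onLattice Cx e , Cell.onLattice Cy lo)
  T₂∈L : T₂ ∈ L
  T₂∈L = Equivalence.from (L↔ T₂)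
    ( (x-window (opposite e) , y-window hi)
    , corner (Cell.index Cx) (opposite e) , corner (Cell.index Cy) hi , even₂
    , Cell.onLattice Cx (opposite e) , Cell.onLattice Cy hi)
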